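{- Let $\mathbf{S}$ be a hereditary closed set of positions of a ruleset. Suppose that for every position $G\in\mathbf{S}$, every pair $(G^L,G^R)\in G^{\mathcal{L}}\times G^{\mathcal{R}}$ satisfies the F1 property or the F2 property. Then every position $G\in\mathbf{S}$ is a number.
   Context: We work in normal-play combinatorial game theory with short partizan games and the usual partial order $\leqslant$ on game values. For a position $G$, $G^{\mathcal{L}}$ and $G^{\mathcal{R}}$ denote its sets of Left and Right options; for an option $G^L$, $G^{L\mathcal{R}}$ denotes the set of Right options of $G^L$, and for $G^R$, $G^{R\mathcal{L}}$ denotes the set of Left options of $G^R$. A "number" is a game equal to a surreal number (dyadic rational). A set $\mathbf{S}$ of positions is a hereditary closed set of positions of a ruleset (HCR) if it is closed under taking options. For $G\in\mathbf{S}$, a pair $(G^L,G^R)\in G^{\mathcal{L}}\times G^{\mathcal{R}}$ satisfies the F1 property if there is $G^{RL}\in G^{R\mathcal{L}}$ with $G^{RL}\geqslant G^L$, or there is $G^{LR}\in G^{L\mathcal{R}}$ with $G^{LR}\leqslant G^R$. The pair satisfies the F2 property if there are $G^{LR}\in G^{L\mathcal{R}}$ and $G^{RL}\in G^{R\mathcal{L}}$ with $G^{RL}\geqslant G^{LR}$. -}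

module Defs where

open import Data.List using (List)
open import Data.List.Membership.Propositional using (_∈_)
open import Data.Product using (Σ; ∃; _×_)
open import Data.Sum using (_⊎_)

data Game : Set where
  mk : List Game → List Game → Game

Lopts : Game → List Game
Lopts (mk L R) = L

Ropts : Game → List Game
Ropts (mk L R) = R

-- Conway's order, in its standard mutually inductive (positive) form:
--   G ≤ H  iff  no G^L ≥ H  and  no H^R ≤ G,
-- where "G ⧏ H" (G is not ≥ H, i.e. ¬ (H ≤ G)) holds iff
--   some H^L ≥ G  or  some G^R ≤ H.
infix 4 _≤_ _⧏_
data _≤_ : Game → Game → Set
data _⧏_ : Game → Game → Set

data _≤_ where
  le : ∀ {G H} →
       (∀ gl → gl ∈ Lopts G → gl ⧏ H) →
       (∀ hr → hr ∈ Ropts H → G ⧏ hr) →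
       G ≤ H

data _⧏_ where
  lf-left  : ∀ {G H} hl → hl ∈ Lopts H → G ≤ hl → G ⧏ H
  lf-right : ∀ {G H} gr → gr ∈ Ropts G → gr ≤ H → G ⧏ H

_≈_ : Game → Game → Set
G ≈ H = (G ≤ H) × (H ≤ G)

data IsNumberForm : Game → Set where
  numform : ∀ {G} →
    (∀ gl → gl ∈ Lopts G → IsNumberForm gl) →
    (∀ gr → gr ∈ Ropts G → IsNumberForm gr) →
    (∀ gl gr → gl ∈ Lopts G → gr ∈ Ropts G → gl ⧏ gr) →
    IsNumberForm G

IsNumber : Game → Set
IsNumber G = Σ Game λ x → IsNumberForm x × (x ≈ G)

IsHCR : (Game → Set) → Set
IsHCR S = ∀ G → S G →
  (∀ gl → gl ∈ Lopts G → S gl) × (∀ gr → gr ∈ Ropts G → S gr)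

F1 : Game → Game → Set
F1 GL GR = (Σ Game λ grl → grl ∈ Lopts GR × GL ≤ grl)
         ⊎ (Σ Game λ glr → glr ∈ Ropts GL × glr ≤ GR)

F2 : Game → Game → Set
F2 GL GR = Σ Game λ glr → Σ Game λ grl →
  glr ∈ Ropts GL × grl ∈ Lopts GR × glr ≤ grl

-- Every Left option G^L of G is ⧏ every Right option G^R: under F1 this is
-- G^L ≤ G^{RL} ⧏ G^R or G^L ⧏ G^{LR} ≤ G^R; under F2 we get G^L ⧏ G^{LR} ≤ G^{RL},
-- and since G^L and G^{RL} are numbers (by induction, S being hereditary) the
-- relation ⧏ between them is already ≤, so again G^L ≤ G^{RL} ⧏ G^R.
-- A game whose options are numbers with no G^L ≥ G^R is a number: replace each
-- option by an equal number form.
module Submission where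

open import Defs
open import Data.List using (List; _∷_)
open import Data.List.Membership.Propositional using (_∈_; mapWith∈)
open import Data.List.Relation.Unary.Any using (here; there)
open import Data.List.Relation.Unary.Any.Properties using (mapWith∈⁺; mapWith∈⁻)
open import Data.Product using (_×_; _,_; proj₁; proj₂)
open import Data.Sum using (_⊎_; inj₁; inj₂)
open import Relation.Binary.PropositionalEquality using (refl)

AllOptions : (Game → Set) → Game → Set
AllOptions P G = (∀ x → x ∈ Lopts G → P x) × (∀ x → x ∈ Ropts G → P x)

game-ind : (P : Game → Set) → (∀ G → AllOptions P G → P G) → ∀ G → P G
game-ind P step (mk L R) = step (mk L R) (all L , all R)
  where
  all : (xs : List Game) → ∀ x → x ∈ xs → P x
  all (y ∷ ys) x (here refl) = game-ind P step y
  all (y ∷ ys) x (there x∈ys) = all ys x x∈ys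

game-ind₂ : (P : Game → Set) →
  (∀ G → AllOptions (λ x → P x × AllOptions P x) G → P G) → ∀ G → P G
game-ind₂ P step G = proj₁ (game-ind (λ x → P x × AllOptions P x) step₂ G)
  where
  step₂ : ∀ G → AllOptions (λ x → P x × AllOptions P x) G → P G × AllOptions P G
  step₂ G ih@(ihL , ihR) = step G ih , (λ x m → proj₁ (ihL x m)) , (λ x m → proj₁ (ihR x m))

mutual
  ≤-trans : ∀ {a b c} → a ≤ b → b ≤ c → a ≤ c
  ≤-trans a≤b@(le aL aR) (le bL bR) =
    le (λ al m → ⧏-≤-trans (aL al m) (le bL bR)) (λ cr m → ≤-⧏-trans a≤b (bR cr m))

  ≤-⧏-trans : ∀ {a b c} → a ≤ b → b ⧏ c → a ⧏ c
  ≤-⧏-trans a≤b (lf-left cl m b≤cl) = lf-left cl m (≤-trans a≤b b≤cl)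
  ≤-⧏-trans (le aL aR) (lf-right br m br≤c) = ⧏-≤-trans (aR br m) br≤c

  ⧏-≤-trans : ∀ {a b c} → a ⧏ b → b ≤ c → a ⧏ c
  ⧏-≤-trans (lf-left bl m a≤bl) (le bL bR) = ≤-⧏-trans a≤bl (bL bl m)
  ⧏-≤-trans (lf-right ar m ar≤b) b≤c = lf-right ar m (≤-trans ar≤b b≤c)

≤-refl : ∀ G → G ≤ G
≤-refl = game-ind (λ G → G ≤ G) λ G (ihL , ihR) →
  le (λ gl m → lf-left gl m (ihL gl m)) (λ gr m → lf-right gr m (ihR gr m))

Lopt-⧏ : ∀ {G gl} → gl ∈ Lopts G → gl ⧏ G
Lopt-⧏ {gl = gl} m = lf-left gl m (≤-refl gl)

⧏-Ropt : ∀ {G gr} → gr ∈ Ropts G → G ⧏ gr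
⧏-Ropt {gr = gr} m = lf-right gr m (≤-refl gr)

numberForm-Lopt-≤ : ∀ {x xl} → IsNumberForm x → xl ∈ Lopts x → xl ≤ x
numberForm-Lopt-≤ {xl = xl} (numform nL nR lf) m =
  le (λ xll m' → lf-left xl m (numberForm-Lopt-≤ (nL xl m) m')) (λ xr m' → lf xl xr m m')

numberForm-≤-Ropt : ∀ {x xr} → IsNumberForm x → xr ∈ Ropts x → x ≤ xr
numberForm-≤-Ropt {xr = xr} (numform nL nR lf) m =
  le (λ xl m' → lf xl xr m' m) (λ xrr m' → lf-right xr m (numberForm-≤-Ropt (nR xr m) m'))

numberForm-⧏⇒≤ : ∀ {x y} → IsNumberForm x → IsNumberForm y → x ⧏ y → x ≤ y
numberForm-⧏⇒≤ nx ny (lf-left yl m x≤yl) = ≤-trans x≤yl (numberForm-Lopt-≤ ny m)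
numberForm-⧏⇒≤ nx ny (lf-right xr m xr≤y) = ≤-trans (numberForm-≤-Ropt nx m) xr≤y

number-⧏⇒≤ : ∀ {a b} → IsNumber a → IsNumber b → a ⧏ b → a ≤ b
number-⧏⇒≤ (x , nx , x≤a , a≤x) (y , ny , y≤b , b≤y) a⧏b =
  ≤-trans a≤x (≤-trans (numberForm-⧏⇒≤ nx ny (≤-⧏-trans x≤a (⧏-≤-trans a⧏b b≤y))) y≤b)

∈-mapWith∈ : ∀ {xs : List Game} (f : ∀ {x} → x ∈ xs → Game) {x} (x∈xs : x ∈ xs) →
  f x∈xs ∈ mapWith∈ xs f
∈-mapWith∈ f x∈xs = mapWith∈⁺ f (_ , x∈xs , refl)

∀-mapWith∈ : ∀ {Q : Game → Set} (xs : List Game) (f : ∀ {x} → x ∈ xs → Game) →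
  (∀ {x} (x∈xs : x ∈ xs) → Q (f x∈xs)) → ∀ y → y ∈ mapWith∈ xs f → Q y
∀-mapWith∈ xs f q y y∈ with mapWith∈⁻ xs f y∈
... | _ , x∈xs , refl = q x∈xs

replaceOptions : (L R : List Game) →
  (∀ {x} → x ∈ L → Game) → (∀ {x} → x ∈ R → Game) → Game
replaceOptions L R fL fR = mk (mapWith∈ L fL) (mapWith∈ R fR)

replaceOptions-≈ : ∀ L R (fL : ∀ {x} → x ∈ L → Game) (fR : ∀ {x} → x ∈ R → Game) →
  (∀ {x} (m : x ∈ L) → fL m ≈ x) → (∀ {x} (m : x ∈ R) → fR m ≈ x) →
  replaceOptions L R fL fR ≈ mk L R
replaceOptions-≈ L R fL fR fL≈ fR≈ = G'≤G , G≤G'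
  where
  G'≤G : replaceOptions L R fL fR ≤ mk L R
  G'≤G = le (∀-mapWith∈ L fL λ m → lf-left _ m (proj₁ (fL≈ m)))
            (λ gr m → lf-right (fR m) (∈-mapWith∈ fR m) (proj₁ (fR≈ m)))
  G≤G' : mk L R ≤ replaceOptions L R fL fR
  G≤G' = le (λ gl m → lf-left (fL m) (∈-mapWith∈ fL m) (proj₂ (fL≈ m)))
            (∀-mapWith∈ R fR λ m → lf-right _ m (proj₂ (fR≈ m)))

number-of-options : ∀ {G} →
  (∀ x → x ∈ Lopts G → IsNumber x) → (∀ x → x ∈ Ropts G → IsNumber x) →
  (∀ gl gr → gl ∈ Lopts G → gr ∈ Ropts G → gl ⧏ gr) → IsNumber G
number-of-options {mk L R} nL nR lf =
  replaceOptions L R fL fR , form , replaceOptions-≈ L R fL fR fL≈ fR≈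
  where
  fL : ∀ {x} → x ∈ L → Game
  fL m = proj₁ (nL _ m)
  fR : ∀ {x} → x ∈ R → Game
  fR m = proj₁ (nR _ m)
  fL≈ : ∀ {x} (m : x ∈ L) → fL m ≈ x
  fL≈ m = proj₂ (proj₂ (nL _ m))
  fR≈ : ∀ {x} (m : x ∈ R) → fR m ≈ x
  fR≈ m = proj₂ (proj₂ (nR _ m))
  fL⧏fR : ∀ {x y} (ml : x ∈ L) (mr : y ∈ R) → fL ml ⧏ fR mr
  fL⧏fR ml mr = ≤-⧏-trans (proj₁ (fL≈ ml)) (⧏-≤-trans (lf _ _ ml mr) (proj₂ (fR≈ mr)))
  form : IsNumberForm (replaceOptions L R fL fR)
  form = numform (∀-mapWith∈ L fL λ m → proj₁ (proj₂ (nL _ m)))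
                 (∀-mapWith∈ R fR λ m → proj₁ (proj₂ (nR _ m)))
                 λ y z y∈ z∈ → ∀-mapWith∈ L fL (λ ml → ∀-mapWith∈ R fR (fL⧏fR ml) z z∈) y y∈

F1⇒⧏ : ∀ {gl gr} → F1 gl gr → gl ⧏ gr
F1⇒⧏ (inj₁ (grl , grl∈ , gl≤grl)) = ≤-⧏-trans gl≤grl (Lopt-⧏ grl∈)
F1⇒⧏ (inj₂ (glr , glr∈ , glr≤gr)) = ⧏-≤-trans (⧏-Ropt glr∈) glr≤gr

F2⇒⧏ : ∀ {gl gr} → IsNumber gl → (∀ x → x ∈ Lopts gr → IsNumber x) →
  F2 gl gr → gl ⧏ gr
F2⇒⧏ ngl ngrL (glr , grl , glr∈ , grl∈ , glr≤grl) =
  ≤-⧏-trans (number-⧏⇒≤ ngl (ngrL grl grl∈) (⧏-≤-trans (⧏-Ropt glr∈) glr≤grl))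
            (Lopt-⧏ grl∈)

mainTheorem2 : (S : Game → Set) → IsHCR S →
    (∀ G → S G → ∀ gl gr → gl ∈ Lopts G → gr ∈ Ropts G → F1 gl gr ⊎ F2 gl gr) →
    ∀ G → S G → IsNumber G
mainTheorem2 S hcr f1⊎f2 = game-ind₂ (λ G → S G → IsNumber G) step
  where
  step : ∀ G →
    AllOptions (λ x → (S x → IsNumber x) × AllOptions (λ y → S y → IsNumber y) x) G →
    S G → IsNumber G
  step G (ihL , ihR) sG = number-of-options nL nR gl⧏gr
    where
    nL : ∀ x → x ∈ Lopts G → IsNumber x
    nL x m = proj₁ (ihL x m) (proj₁ (hcr G sG) x m)
    nR : ∀ x → x ∈ Ropts G → IsNumber x
    nR x m = proj₁ (ihR x m) (proj₂ (hcr G sG) x m)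
    nRL : ∀ gr → gr ∈ Ropts G → ∀ x → x ∈ Lopts gr → IsNumber x
    nRL gr m x m' = proj₁ (proj₂ (ihR gr m)) x m' (proj₁ (hcr gr (proj₂ (hcr G sG) gr m)) x m')
    gl⧏gr : ∀ gl gr → gl ∈ Lopts G → gr ∈ Ropts G → gl ⧏ gr
    gl⧏gr gl gr ml mr with f1⊎f2 G sG gl gr ml mr
    ... | inj₁ f1 = F1⇒⧏ f1
    ... | inj₂ f2 = F2⇒⧏ (nL gl ml) (nRL gr mr) f2
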